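{- Let $n\in\mathbb N$, $b\in\mathbb Z$, and real $P>0$. Let $S(P;n,b)$ denote the number of integers $y\in[-P,P]$ such that $ny+b$ is a perfect square, and let $k^2$ be the largest square dividing $\gcd(n,b)$. Then for every $\varepsilon>0$, \[ S(P;n,b)\ll n^{\varepsilon}\left(1+k\sqrt{\frac{P}{n}}\right). \]
   Context: The implicit constant in $\ll$ depends only on $\varepsilon$. A perfect square means the square of an integer. -}

module Defs where

open import Data.Nat as ℕ using (ℕ; zero; suc; _≤_; _<_; s≤s; z≤n)
import Data.Nat.Properties as ℕP
open import Data.Nat.Divisibility using (_∣_)
open import Data.Integer as ℤ using (ℤ; +_; -[1+_])
import Data.Integer.Properties as ℤP
open import Data.Fin using (Fin; toℕ; fromℕ<)
open import Data.Fin.Properties using (any?; toℕ-fromℕ<)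
open import Data.List using (List; map; upTo; filter; length)
open import Data.Product using (∃; ∃-syntax; _,_)
open import Relation.Nullary using (Dec; yes; no)
open import Relation.Unary using (Decidable)
open import Relation.Binary.PropositionalEquality using (_≡_; refl; sym; trans; cong)

-- z is a perfect square: the square of an integer (equivalently of a natural,
-- since (-m)^2 = m^2).
IsSquare : ℤ → Set
IsSquare z = ∃[ m ] z ≡ + (m ℕ.* m)

private
  sq-bound : ∀ m t → m ℕ.* m ≡ t → m < suc t
  sq-bound zero    t eq = s≤s z≤n
  sq-bound (suc m) t eq = s≤s (ℕP.≤-trans (ℕP.m≤m*n (suc m) (suc m)) (ℕP.≤-reflexive eq))

isSquare? : Decidable IsSquare
isSquare? -[1+ t ] = no λ { (m , ()) }
isSquare? (+ t) with any? {n = suc t} (λ (i : Fin (suc t)) → toℕ i ℕ.* toℕ i ℕ.≟ t)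
... | yes (i , eq) = yes (toℕ i , cong +_ (sym eq))
... | no ¬p = no λ { (m , eq) → ¬p (fromℕ< (sq-bound m t (sym (ℤP.+-injective eq))) ,
         trans (cong (λ x → x ℕ.* x) (toℕ-fromℕ< (sq-bound m t (sym (ℤP.+-injective eq)))))
               (sym (ℤP.+-injective eq))) }

range : ℕ → List ℤ
range P = map (λ i → (+ i) ℤ.- (+ P)) (upTo (suc (2 ℕ.* P)))

S : ℕ → ℕ → ℤ → ℕ
S P n b = length (filter (λ y → isSquare? ((+ n) ℤ.* y ℤ.+ b)) (range P))

IsLargestSquareDivisor : ℕ → ℕ → Set
IsLargestSquareDivisor k g = (k ℕ.* k ∣ g) × (∀ j → j ℕ.* j ∣ g → j ℕ.* j ≤ k ℕ.* k)
  where open import Data.Product using (_×_)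

{-# OPTIONS --safe #-}

-- The roots m ≥ 0 of n y + b = m², y ∈ [-P, P], increase with y, and any two of them satisfy
-- m′² - m² = n t with 0 ≤ t ≤ 2P. Fix the smallest root m₀ and sort the roots into classes by
-- d = gcd(n, m - m₀). As n ∣ (m - m₀)(m + m₀), two roots of one class differ by a multiple of
-- lcm(d, n/d) = n/h, where h = gcd(d, n/d) satisfies h² ∣ n and h ∣ 2m₀. A divisor e of both m₀
-- and h has e² ∣ gcd(n, b), hence e ≤ k, and taking e = h or h/2 gives h ≤ 2k. A class of size s
-- therefore spans at least (s - 1) n/(2k) but at most √(2nP), i.e. (s - 1)² n ≤ 8k²P. There are
-- at most τ(n) classes, and τ(n)^q ≤ C_q n: a prime power p^a contributes (a + 1)^q ≤ p^a once
-- p ≥ 2^q, and (a + 1)^q ≤ q^q p^a for each of the finitely many smaller primes.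
module Submission where

open import Defs
open import Data.Nat
open import Data.Nat.Properties
open import Data.Nat.Divisibility
open import Data.Nat.DivMod using (_/_; _%_; m≡m%n+[m/n]*n; m%n<n; m*[n/m]≡n; /-congʳ)
open import Data.Nat.GCD using (gcd; gcd[m,n]∣m; gcd[m,n]∣n; gcd[m,n]≢0; gcd[m,n]≤n; gcd-greatest)
open import Data.Nat.LCM using (lcm; lcm-least; gcd*lcm)
open import Data.Nat.Coprimality using (Coprime; coprime-divisor; coprime-/gcd)
open import Data.Nat.Primality
  using (Prime; prime⇒nonZero; prime⇒irreducible; _Rough_; 2-rough; rough⇒≤; ∤⇒rough-suc
        ; rough∧∣⇒rough; rough∧∣⇒prime)
open import Data.Nat.Induction using (<-wellFounded)
open import Data.Nat.Tactic.RingSolver using (solve-∀)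
open import Data.Integer as ℤ using (ℤ; +_)
import Data.Integer.Properties as ℤₚ
import Data.Integer.Divisibility.Signed as Signed
open import Data.Integer.Tactic.RingSolver using () renaming (solve-∀ to ℤ-solve-∀)
open import Data.List using (List; []; _∷_; _++_; map; length; filter; upTo)
open import Data.List.Properties using (length-++; length-map)
open import Data.List.Membership.Propositional using (_∈_)
open import Data.List.Membership.Propositional.Properties using (∈-++⁺ˡ; ∈-++⁺ʳ; ∈-map⁺)
open import Data.List.Relation.Unary.Any using (here; there)
open import Data.List.Relation.Unary.All as All using (All; []; _∷_)
import Data.List.Relation.Unary.All.Properties as Allₚ
open import Data.List.Relation.Unary.AllPairs using (AllPairs; []; _∷_)
import Data.List.Relation.Unary.AllPairs.Properties as AllPairsₚ
open import Data.List.Extrema.Nat using (f[xs]≤f[argmax])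
open import Data.Bool using (true; false)
open import Data.Product using (∃-syntax; ∃₂; _×_; _,_; proj₁; proj₂)
open import Data.Sum using (inj₁; inj₂)
open import Function using (_∘_; id)
open import Induction.WellFounded using (Acc; acc)
open import Level using (Level)
open import Relation.Binary using (Rel)
open import Relation.Binary.PropositionalEquality
open import Relation.Nullary using (yes; no; does; ¬?; contradiction)
open import Relation.Unary using (Pred; Decidable)

private
  variable
    a b ℓ ℓ′ ℓ″ : Level
    A : Set a
    B : Set b

^-distribʳ-* : ∀ m n o → (m * n) ^ o ≡ m ^ o * n ^ o
^-distribʳ-* m n zero    = refl
^-distribʳ-* m n (suc o) =
  trans (cong (m * n *_) (^-distribʳ-* m n o)) ([m*n]*[o*p]≡[m*o]*[n*p] m n (m ^ o) (n ^ o))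

x^[2*q]≡[x*x]^q : ∀ x q → x ^ (2 * q) ≡ (x * x) ^ q
x^[2*q]≡[x*x]^q x q = trans (sym (^-*-assoc x 2 q)) (cong (λ y → (x * y) ^ q) (*-identityʳ x))

1+n≤2^n : ∀ n → suc n ≤ 2 ^ n
1+n≤2^n zero    = s≤s z≤n
1+n≤2^n (suc n) = begin
  suc (suc n)   ≡⟨ +-comm 1 (suc n) ⟩
  suc n + 1     ≤⟨ +-mono-≤ (1+n≤2^n n) (m^n>0 2 n) ⟩
  2 ^ n + 2 ^ n ≡⟨ cong (λ x → 2 ^ n + x) (sym (+-identityʳ (2 ^ n))) ⟩
  2 * 2 ^ n     ∎
  where open ≤-Reasoning

[m∸o]∸[n∸o]≡m∸n : ∀ {m n o} → o ≤ n → n ≤ m → (m ∸ o) ∸ (n ∸ o) ≡ m ∸ n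
[m∸o]∸[n∸o]≡m∸n {o = zero}              z≤n       _         = refl
[m∸o]∸[n∸o]≡m∸n {suc m} {suc n} {suc o} (s≤s o≤n) (s≤s n≤m) = [m∸o]∸[n∸o]≡m∸n o≤n n≤m

[m+o]∸[n+o]≡m∸n : ∀ m n o → (m + o) ∸ (n + o) ≡ m ∸ n
[m+o]∸[n+o]≡m∸n m n o = trans (cong₂ _∸_ (+-comm m o) (+-comm n o)) ([m+n]∸[m+o]≡n∸o o m n)

[m∸n]*[m+n]≡m*m∸n*n : ∀ m n → (m ∸ n) * (m + n) ≡ m * m ∸ n * n
[m∸n]*[m+n]≡m*m∸n*n m n = begin
  (m ∸ n) * (m + n)                 ≡⟨ *-distribʳ-∸ (m + n) m n ⟩
  m * (m + n) ∸ n * (m + n)         ≡⟨ cong₂ _∸_ (*-distribˡ-+ m m n) (*-distribˡ-+ n m n) ⟩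
  (m * m + m * n) ∸ (n * m + n * n) ≡⟨ cong (m * m + m * n ∸_) nm+nn≡nn+mn ⟩
  (m * m + m * n) ∸ (n * n + m * n) ≡⟨ [m+o]∸[n+o]≡m∸n (m * m) (n * n) (m * n) ⟩
  m * m ∸ n * n                     ∎
  where
  open ≡-Reasoning
  nm+nn≡nn+mn : n * m + n * n ≡ n * n + m * n
  nm+nn≡nn+mn = trans (+-comm (n * m) (n * n)) (cong (λ x → n * n + x) (*-comm n m))

m*m≤n*n⇒m≤n : ∀ {m n} → m * m ≤ n * n → m ≤ n
m*m≤n*n⇒m≤n m*m≤n*n = ≮⇒≥ (λ n<m → <⇒≱ (*-mono-< n<m n<m) m*m≤n*n)

square-gap : ∀ {x z L T} → x + L ≤ z → z * z ≡ x * x + T → L * L ≤ T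
square-gap {x} {z} {L} {T} x+L≤z z*z≡ = +-cancelˡ-≤ (x * x) _ _ (begin
  x * x + L * L                   ≤⟨ m≤m+n _ (x * L + x * L) ⟩
  x * x + L * L + (x * L + x * L) ≡⟨ expand x L ⟩
  (x + L) * (x + L)               ≤⟨ *-mono-≤ x+L≤z x+L≤z ⟩
  z * z                           ≡⟨ z*z≡ ⟩
  x * x + T                       ∎)
  where
  open ≤-Reasoning
  expand : ∀ x L → x * x + L * L + (x * L + x * L) ≡ (x + L) * (x + L)
  expand = solve-∀

∣-∸ : ∀ {d m n} → m ≤ n → d ∣ m → d ∣ n → d ∣ n ∸ m
∣-∸ {d} m≤n d∣m d∣n = ∣m+n∣m⇒∣n (subst (d ∣_) (sym (m+[n∸m]≡n m≤n)) d∣n) d∣m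

<∧∣∸⇒+≤ : ∀ {N y z} → y < z → N ∣ z ∸ y → y + N ≤ z
<∧∣∸⇒+≤ {N} {y} {z} y<z N∣z∸y =
  let instance _ = >-nonZero (m<n⇒0<n∸m y<z)
  in subst (_≤ z) (+-comm N y) (m≤o∸n⇒m+n≤o N (<⇒≤ y<z) (∣⇒≤ N∣z∸y))

prime∤⇒coprime : ∀ {p e} → Prime p → p ∤ e → Coprime e p
prime∤⇒coprime pr p∤e (d∣e , d∣p) with prime⇒irreducible pr d∣p
... | inj₁ d≡1 = d≡1
... | inj₂ refl = contradiction d∣e p∤e

factorOut : ∀ {p n} .{{_ : NonTrivial p}} .{{_ : NonZero n}} → p ∣ n →
            ∃₂ λ a m → n ≡ p ^ suc a * m × p ∤ m × m < n
factorOut {p} {n} = go n (<-wellFounded n)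
  where
  go : ∀ n .{{_ : NonZero n}} → Acc _<_ n → p ∣ n → ∃₂ λ a m → n ≡ p ^ suc a * m × p ∤ m × m < n
  go n (acc rec) p∣n with p ∣? quotient p∣n
  ... | no p∤n/p =
    0 , quotient p∣n ,
    trans (m∣n⇒n≡m*quotient p∣n) (cong (_* quotient p∣n) (sym (*-identityʳ p))) ,
    p∤n/p , quotient-< p∣n
  ... | yes p∣n/p =
    let instance _ = quotient≢0 p∣n
        a , m , n/p≡ , p∤m , m<n/p = go (quotient p∣n) (rec (quotient-< p∣n)) p∣n/p
    in suc a , m ,
       trans (m∣n⇒n≡m*quotient p∣n) (trans (cong (p *_) n/p≡) (sym (*-assoc p _ m))) ,
       p∤m , <-trans m<n/p (quotient-< p∣n)

smallestFactor : ∀ {n B} .{{_ : NonTrivial n}} → B Rough n → ∃[ p ] B ≤ p × p ∣ n × p Rough n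
smallestFactor {n} {B} B-rough = go (n ∸ B) (m+[n∸m]≡n (rough⇒≤ B-rough)) B-rough
  where
  go : ∀ k {B} → B + k ≡ n → B Rough n → ∃[ p ] B ≤ p × p ∣ n × p Rough n
  go k {B} B+k≡n B-rough with B ∣? n
  ... | yes B∣n = B , ≤-refl , B∣n , B-rough
  go zero    {B} B+0≡n B-rough | no B∤n =
    contradiction (subst (B ∣_) B+0≡n (∣m∣n⇒∣m+n ∣-refl (B ∣0))) B∤n
  go (suc k) {B} B+k≡n B-rough | no B∤n =
    let p , 1+B≤p , p∣n , p-rough = go k (trans (sym (+-suc B k)) B+k≡n) (∤⇒rough-suc B∤n B-rough)
    in p , <⇒≤ 1+B≤p , p∣n , p-rough

∣p^a*m⇒≡p^i*∣m : ∀ {p e} a m → Prime p → e ∣ p ^ a * m →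
                 ∃₂ λ i e′ → i ≤ a × e′ ∣ m × e ≡ p ^ i * e′
∣p^a*m⇒≡p^i*∣m {p} {e} zero m _ e∣m =
  0 , e , z≤n , subst (e ∣_) (+-identityʳ m) e∣m , sym (+-identityʳ e)
∣p^a*m⇒≡p^i*∣m {p} {e} (suc a) m pr e∣p^a*m with p ∣? e
... | yes p∣e =
  let instance _ = prime⇒nonZero pr
      e₁∣p^a*m = *-cancelˡ-∣ p (subst₂ _∣_ (m∣n⇒n≡m*quotient p∣e) (*-assoc p (p ^ a) m) e∣p^a*m)
      i , e′ , i≤a , e′∣m , e₁≡ = ∣p^a*m⇒≡p^i*∣m a m pr e₁∣p^a*m
  in suc i , e′ , s≤s i≤a , e′∣m ,
     trans (m∣n⇒n≡m*quotient p∣e) (trans (cong (p *_) e₁≡) (sym (*-assoc p (p ^ i) e′)))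
... | no p∤e =
  let e∣p^a*m = coprime-divisor (prime∤⇒coprime pr p∤e) (subst (e ∣_) (*-assoc p (p ^ a) m) e∣p^a*m)
      i , e′ , i≤a , e′∣m , e≡ = ∣p^a*m⇒≡p^i*∣m a m pr e∣p^a*m
  in i , e′ , m≤n⇒m≤1+n i≤a , e′∣m , e≡

DivisorCover : ℕ → List ℕ → Set
DivisorCover n D = ∀ {e} → e ∣ n → e ∈ D

powerMultiples : ℕ → ℕ → List ℕ → List ℕ
powerMultiples p zero    D = D
powerMultiples p (suc a) D = D ++ map (p *_) (powerMultiples p a D)

length-powerMultiples : ∀ p a D → length (powerMultiples p a D) ≡ suc a * length D
length-powerMultiples p zero    D = sym (+-identityʳ (length D))
length-powerMultiples p (suc a) D = begin
  length (D ++ map (p *_) (powerMultiples p a D))       ≡⟨ length-++ D ⟩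
  length D + length (map (p *_) (powerMultiples p a D)) ≡⟨ cong (λ x → length D + x) |p*pM|≡ ⟩
  length D + suc a * length D                           ∎
  where
  open ≡-Reasoning
  |p*pM|≡ : length (map (p *_) (powerMultiples p a D)) ≡ suc a * length D
  |p*pM|≡ = trans (length-map (p *_) (powerMultiples p a D)) (length-powerMultiples p a D)

p^i*∈powerMultiples : ∀ p {a i e} D → i ≤ a → e ∈ D → p ^ i * e ∈ powerMultiples p a D
p^i*∈powerMultiples p {zero}  {e = e} D z≤n e∈D = subst (_∈ D) (sym (+-identityʳ e)) e∈D
p^i*∈powerMultiples p {suc a} {e = e} D z≤n e∈D = ∈-++⁺ˡ (subst (_∈ D) (sym (+-identityʳ e)) e∈D)
p^i*∈powerMultiples p {suc a} {suc i} {e} D (s≤s i≤a) e∈D =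
  ∈-++⁺ʳ D (subst (_∈ map (p *_) (powerMultiples p a D)) (sym (*-assoc p (p ^ i) e))
                  (∈-map⁺ (p *_) (p^i*∈powerMultiples p D i≤a e∈D)))

powerMultiples-cover : ∀ {p m D} a → Prime p → DivisorCover m D →
                       DivisorCover (p ^ a * m) (powerMultiples p a D)
powerMultiples-cover {D = D} a pr cover e∣p^a*m =
  let i , e′ , i≤a , e′∣m , e≡ = ∣p^a*m⇒≡p^i*∣m a _ pr e∣p^a*m
  in subst (_∈ _) (sym e≡) (p^i*∈powerMultiples _ D i≤a (cover e′∣m))

module DivisorBound (q : ℕ) .{{_ : NonZero q}} where

  Q R : ℕ
  Q = q ^ q
  R = 2 ^ q

  instance
    Q≢0 : NonZero Q
    Q≢0 = m^n≢0 q q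

  [1+a]^q≤p^a : ∀ {p} a → R ≤ p → suc a ^ q ≤ p ^ a
  [1+a]^q≤p^a {p} a R≤p = begin
    suc a ^ q   ≤⟨ ^-monoˡ-≤ q (1+n≤2^n a) ⟩
    (2 ^ a) ^ q ≡⟨ ^-*-assoc 2 a q ⟩
    2 ^ (a * q) ≡⟨ cong (2 ^_) (*-comm a q) ⟩
    2 ^ (q * a) ≡⟨ sym (^-*-assoc 2 q a) ⟩
    R ^ a       ≤⟨ ^-monoˡ-≤ a R≤p ⟩
    p ^ a       ∎
    where open ≤-Reasoning

  [1+a]^q≤Q*p^a : ∀ {p} a → 2 ≤ p → suc a ^ q ≤ Q * p ^ a
  [1+a]^q≤Q*p^a {p} a 2≤p = begin
    suc a ^ q       ≤⟨ ^-monoˡ-≤ q 1+a≤2^t*q ⟩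
    (2 ^ t * q) ^ q ≡⟨ ^-distribʳ-* (2 ^ t) q q ⟩
    (2 ^ t) ^ q * Q ≡⟨ cong (_* Q) (^-*-assoc 2 t q) ⟩
    2 ^ (t * q) * Q ≤⟨ *-monoˡ-≤ Q (^-monoʳ-≤ 2 t*q≤a) ⟩
    2 ^ a * Q       ≡⟨ *-comm (2 ^ a) Q ⟩
    Q * 2 ^ a       ≤⟨ *-monoʳ-≤ Q (^-monoˡ-≤ a 2≤p) ⟩
    Q * p ^ a       ∎
    where
    open ≤-Reasoning
    t = a / q
    t*q≤a : t * q ≤ a
    t*q≤a = ≤-trans (m≤n+m (t * q) (a % q)) (≤-reflexive (sym (m≡m%n+[m/n]*n a q)))
    1+a≤2^t*q : suc a ≤ 2 ^ t * q
    1+a≤2^t*q = begin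
      suc a               ≡⟨ cong suc (m≡m%n+[m/n]*n a q) ⟩
      suc (a % q) + t * q ≤⟨ +-monoˡ-≤ (t * q) (m%n<n a q) ⟩
      suc t * q           ≤⟨ *-monoˡ-≤ q (1+n≤2^n t) ⟩
      2 ^ t * q           ∎

  [1+a]^q*Q^[R∸1+p]≤Q^[R∸p]*p^a : ∀ {p} a → 2 ≤ p →
                                  suc a ^ q * Q ^ (R ∸ suc p) ≤ Q ^ (R ∸ p) * p ^ a
  [1+a]^q*Q^[R∸1+p]≤Q^[R∸p]*p^a {p} a 2≤p with R ≤? p
  ... | yes R≤p = begin
    suc a ^ q * Q ^ (R ∸ suc p) ≤⟨ *-mono-≤ ([1+a]^q≤p^a a R≤p) (^-monoʳ-≤ Q (∸-monoʳ-≤ R (n≤1+n p))) ⟩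
    p ^ a * Q ^ (R ∸ p)         ≡⟨ *-comm (p ^ a) _ ⟩
    Q ^ (R ∸ p) * p ^ a         ∎
    where open ≤-Reasoning
  ... | no R≰p = begin
    suc a ^ q * Q ^ (R ∸ suc p) ≤⟨ *-monoˡ-≤ _ ([1+a]^q≤Q*p^a a 2≤p) ⟩
    Q * p ^ a * Q ^ (R ∸ suc p) ≡⟨ swap Q (p ^ a) (Q ^ (R ∸ suc p)) ⟩
    Q ^ suc (R ∸ suc p) * p ^ a ≡⟨ cong (λ k → Q ^ k * p ^ a) (sym (+-∸-assoc 1 (≰⇒> R≰p))) ⟩
    Q ^ (R ∸ p) * p ^ a         ∎
    where
    open ≤-Reasoning
    swap : ∀ x y z → x * y * z ≡ x * z * y
    swap = solve-∀

  powerMultiples-bound : ∀ {p m} a D → 2 ≤ p → length D ^ q ≤ Q ^ (R ∸ suc p) * m →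
                         length (powerMultiples p a D) ^ q ≤ Q ^ (R ∸ p) * (p ^ a * m)
  powerMultiples-bound {p} {m} a D 2≤p |D|^q≤ = begin
    length (powerMultiples p a D) ^ q ≡⟨ cong (_^ q) (length-powerMultiples p a D) ⟩
    (suc a * length D) ^ q            ≡⟨ ^-distribʳ-* (suc a) (length D) q ⟩
    suc a ^ q * length D ^ q          ≤⟨ *-monoʳ-≤ (suc a ^ q) |D|^q≤ ⟩
    suc a ^ q * (Q ^ (R ∸ suc p) * m) ≡⟨ sym (*-assoc (suc a ^ q) _ m) ⟩
    suc a ^ q * Q ^ (R ∸ suc p) * m   ≤⟨ *-monoˡ-≤ m ([1+a]^q*Q^[R∸1+p]≤Q^[R∸p]*p^a a 2≤p) ⟩
    Q ^ (R ∸ p) * p ^ a * m           ≡⟨ *-assoc (Q ^ (R ∸ p)) (p ^ a) m ⟩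
    Q ^ (R ∸ p) * (p ^ a * m)         ∎
    where open ≤-Reasoning

  -- Q ^ (R ∸ B) pays q^q for each prime below R = 2^q that may still divide the B-rough n.
  roughCover : ∀ n .{{_ : NonZero n}} → Acc _<_ n → ∀ {B} → 2 ≤ B → B Rough n →
               ∃[ D ] DivisorCover n D × length D ^ q ≤ Q ^ (R ∸ B) * n
  roughCover 1 _ {B} _ _ = 1 ∷ [] , (λ e∣1 → here (∣1⇒≡1 e∣1)) , (begin
    1 ^ q           ≡⟨ ^-zeroˡ q ⟩
    1               ≤⟨ m^n>0 Q (R ∸ B) ⟩
    Q ^ (R ∸ B)     ≡⟨ sym (*-identityʳ _) ⟩
    Q ^ (R ∸ B) * 1 ∎)
    where open ≤-Reasoning
  roughCover n@(2+ _) (acc rec) {B} 2≤B B-rough with smallestFactor B-rough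
  ... | p , B≤p , p∣n , p-rough with factorOut {{n>1⇒nonTrivial (≤-trans 2≤B B≤p)}} p∣n
  ... | a , zero , n≡p^a*0 , _ , _ = contradiction (trans n≡p^a*0 (*-zeroʳ (p ^ suc a))) λ ()
  ... | a , m@(suc _) , n≡p^a*m , p∤m , m<n =
    let 2≤p = ≤-trans 2≤B B≤p
        instance _ = n>1⇒nonTrivial 2≤p
        m-rough = ∤⇒rough-suc p∤m (rough∧∣⇒rough p-rough (divides (p ^ suc a) n≡p^a*m))
        D , cover , |D|^q≤ = roughCover m (rec m<n) (m≤n⇒m≤1+n 2≤p) m-rough
        D′ = powerMultiples p (suc a) D
    in D′ ,
       subst (λ k → DivisorCover k D′) (sym n≡p^a*m)
             (powerMultiples-cover (suc a) (rough∧∣⇒prime p-rough p∣n) cover) ,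
       ≤-trans (powerMultiples-bound (suc a) D 2≤p |D|^q≤)
               (subst (λ k → Q ^ (R ∸ p) * k ≤ Q ^ (R ∸ B) * n) n≡p^a*m
                      (*-monoˡ-≤ n (^-monoʳ-≤ Q (∸-monoʳ-≤ R B≤p))))

  divisorCover : ∀ n .{{_ : NonZero n}} → ∃[ D ] DivisorCover n D × length D ^ q ≤ Q ^ R * n
  divisorCover n =
    let D , cover , bound = roughCover n (<-wellFounded n) ≤-refl 2-rough
    in D , cover , ≤-trans bound (*-monoˡ-≤ n (^-monoʳ-≤ Q (m∸n≤m R 2)))

filter-map : ∀ {P : Pred B ℓ} (P? : Decidable P) (f : A → B) xs →
             filter P? (map f xs) ≡ map f (filter (P? ∘ f) xs)
filter-map P? f []       = refl
filter-map P? f (x ∷ xs) with does (P? (f x))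
... | true  = cong (f x ∷_) (filter-map P? f xs)
... | false = filter-map P? f xs

length-filter-split : ∀ {P : Pred A ℓ} (P? : Decidable P) xs →
                      length xs ≡ length (filter P? xs) + length (filter (¬? ∘ P?) xs)
length-filter-split P? []       = refl
length-filter-split P? (x ∷ xs) with does (P? x)
... | true  = cong suc (length-filter-split P? xs)
... | false = trans (cong suc (length-filter-split P? xs)) (sym (+-suc _ _))

length-filter-filter : ∀ {P : Pred A ℓ} {Q : Pred A ℓ′} (P? : Decidable P) (Q? : Decidable Q) xs →
                       length (filter P? (filter Q? xs)) ≤ length (filter P? xs)
length-filter-filter P? Q? []       = z≤n
length-filter-filter P? Q? (x ∷ xs) with does (Q? x)
... | true with does (P? x)
...   | true  = s≤s (length-filter-filter P? Q? xs)
...   | false = length-filter-filter P? Q? xs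
length-filter-filter P? Q? (x ∷ xs) | false with does (P? x)
...   | true  = m≤n⇒m≤1+n (length-filter-filter P? Q? xs)
...   | false = length-filter-filter P? Q? xs

fibre : (A → ℕ) → ℕ → List A → List A
fibre f d = filter (λ x → f x ≟ d)

bounded-fibres⇒length≤ : ∀ (f : A → ℕ) {u} D xs → All (λ x → f x ∈ D) xs →
                         All (λ d → length (fibre f d xs) ≤ u) D → length xs ≤ length D * u
bounded-fibres⇒length≤ f []      []      _        _ = z≤n
bounded-fibres⇒length≤ f []      (_ ∷ _) (() ∷ _) _
bounded-fibres⇒length≤ f {u} (d ∷ D) xs f[xs]∈ (|fibre|≤u ∷ |fibres|≤u) = begin
  length xs                             ≡⟨ length-filter-split (λ x → f x ≟ d) xs ⟩
  length (fibre f d xs) + length others ≤⟨ +-mono-≤ |fibre|≤u |others|≤ ⟩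
  u + length D * u                      ∎
  where
  open ≤-Reasoning
  others = filter (¬? ∘ (λ x → f x ≟ d)) xs
  f[others]∈ : All (λ x → f x ∈ D) others
  f[others]∈ = All.zipWith (λ { (here fx≡d , fx≢d) → contradiction fx≡d fx≢d ; (there fx∈D , _) → fx∈D })
                           (Allₚ.filter⁺ _ f[xs]∈ , Allₚ.all-filter _ xs)
  |others|≤ : length others ≤ length D * u
  |others|≤ = bounded-fibres⇒length≤ f D others f[others]∈
                (All.map (≤-trans (length-filter-filter _ _ xs)) |fibres|≤u)

pigeonhole : ∀ (f : A → ℕ) D xs → All (λ x → f x ∈ D) xs →
             ∃[ d ] length xs ≤ length D * length (fibre f d xs)
pigeonhole f D xs f[xs]∈ =
  _ , bounded-fibres⇒length≤ f D xs f[xs]∈ (f[xs]≤f[argmax] {f = λ d → length (fibre f d xs)} 0 D)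

AllPairs-mapWith : ∀ {P : Pred A ℓ} {R : Rel A ℓ′} {S : Rel A ℓ″} →
                   (∀ {x y} → P x → P y → R x y → S x y) →
                   ∀ {xs} → All P xs → AllPairs R xs → AllPairs S xs
AllPairs-mapWith f []         []         = []
AllPairs-mapWith f (px ∷ pxs) (rx ∷ rxs) =
  All.zipWith (λ (py , rxy) → f px py rxy) (pxs , rx) ∷ AllPairs-mapWith f pxs rxs

separated-spread : ∀ {N x xs} → AllPairs (λ y z → y + N ≤ z) (x ∷ xs) →
                   ∃[ z ] z ∈ x ∷ xs × x + length xs * N ≤ z
separated-spread {x = x} {[]} _ = x , here refl , ≤-reflexive (+-identityʳ x)
separated-spread {N} {x} {y ∷ xs} ((x+N≤y ∷ _) ∷ separated) =
  let z , z∈ , y+LN≤z = separated-spread separated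
  in z , there z∈ , (begin
    x + (N + length xs * N) ≡⟨ sym (+-assoc x N _) ⟩
    x + N + length xs * N   ≤⟨ +-monoˡ-≤ _ x+N≤y ⟩
    y + length xs * N       ≤⟨ y+LN≤z ⟩
    z                       ∎)
  where open ≤-Reasoning

instance
  gcd≢0ˡ : ∀ {m n} .{{_ : NonZero m}} → NonZero (gcd m n)
  gcd≢0ˡ {m} {n} = ≢-nonZero (gcd[m,n]≢0 m n (inj₁ (≢-nonZero⁻¹ m)))

m∣n*o⇒m/gcd[m,n]∣o : ∀ m n o .{{_ : NonZero m}} → m ∣ n * o → m / gcd m n ∣ o
m∣n*o⇒m/gcd[m,n]∣o m n o m∣n*o =
  coprime-divisor (coprime-/gcd m n) (*-cancelˡ-∣ g (subst₂ _∣_ m≡ n*o≡ m∣n*o))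
  where
  g = gcd m n
  m≡ : m ≡ g * (m / g)
  m≡ = sym (m*[n/m]≡n (gcd[m,n]∣m m n))
  n*o≡ : n * o ≡ g * (n / g * o)
  n*o≡ = trans (cong (_* o) (sym (m*[n/m]≡n (gcd[m,n]∣n m n)))) (*-assoc g (n / g) o)

∣2*m⇒half∣m : ∀ {h m} .{{_ : NonZero h}} → h ∣ 2 * m → ∃[ e ] e ∣ m × e ∣ h × h ≤ 2 * e
∣2*m⇒half∣m {h} {m} h∣2m =
  e , m∣n*o⇒m/gcd[m,n]∣o h 2 m h∣2m , m/n∣m (gcd[m,n]∣m h 2) , (begin
    h           ≡⟨ sym (m*[n/m]≡n (gcd[m,n]∣m h 2)) ⟩
    gcd h 2 * e ≤⟨ *-monoˡ-≤ e (gcd[m,n]≤n h 2) ⟩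
    2 * e       ∎)
  where
  open ≤-Reasoning
  e = h / gcd h 2

sameGcd⇒lcm∣∸ : ∀ {n d m₀ m m′} .{{_ : NonZero n}} .{{_ : NonZero d}} → m₀ ≤ m → m ≤ m′ →
                n ∣ (m ∸ m₀) * (m + m₀) → n ∣ (m′ ∸ m₀) * (m′ + m₀) →
                gcd n (m ∸ m₀) ≡ d → gcd n (m′ ∸ m₀) ≡ d → lcm d (n / d) ∣ m′ ∸ m
sameGcd⇒lcm∣∸ {n} {_} {m₀} {m} {m′} m₀≤m m≤m′ n∣ n∣′ refl g′≡g = lcm-least g∣m′∸m n/g∣m′∸m
  where
  g = gcd n (m ∸ m₀)
  g∣m′∸m₀ : g ∣ m′ ∸ m₀
  g∣m′∸m₀ = subst (_∣ m′ ∸ m₀) g′≡g (gcd[m,n]∣n n (m′ ∸ m₀))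
  g∣m′∸m : g ∣ m′ ∸ m
  g∣m′∸m = subst (g ∣_) ([m∸o]∸[n∸o]≡m∸n m₀≤m m≤m′)
                 (∣-∸ (∸-monoˡ-≤ m₀ m≤m′) (gcd[m,n]∣n n (m ∸ m₀)) g∣m′∸m₀)
  n/g∣m′+m₀ : n / g ∣ m′ + m₀
  n/g∣m′+m₀ = subst (_∣ m′ + m₀) (/-congʳ g′≡g) (m∣n*o⇒m/gcd[m,n]∣o n (m′ ∸ m₀) (m′ + m₀) n∣′)
  n/g∣m′∸m : n / g ∣ m′ ∸ m
  n/g∣m′∸m = subst (n / g ∣_) ([m+o]∸[n+o]≡m∸n m′ m m₀)
                   (∣-∸ (+-monoˡ-≤ m₀ m≤m′) (m∣n*o⇒m/gcd[m,n]∣o n (m ∸ m₀) (m + m₀) n∣) n/g∣m′+m₀)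

gcd[d,n/d]*lcm[d,n/d]≡n : ∀ {n d} .{{_ : NonZero d}} → d ∣ n → gcd d (n / d) * lcm d (n / d) ≡ n
gcd[d,n/d]*lcm[d,n/d]≡n {n} {d} d∣n = trans (gcd*lcm d (n / d)) (m*[n/m]≡n d∣n)

gcd[d,n/d]²∣n : ∀ {n d} .{{_ : NonZero d}} → d ∣ n → gcd d (n / d) * gcd d (n / d) ∣ n
gcd[d,n/d]²∣n {n} {d} d∣n = subst (gcd d (n / d) * gcd d (n / d) ∣_) (m*[n/m]≡n d∣n)
                                  (*-pres-∣ (gcd[m,n]∣m d (n / d)) (gcd[m,n]∣n d (n / d)))

gcd[d,n/d]∣2*m₀ : ∀ {n m₀ m} .{{_ : NonZero n}} → m₀ ≤ m → n ∣ (m ∸ m₀) * (m + m₀) →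
                  let d = gcd n (m ∸ m₀) in gcd d (n / d) ∣ 2 * m₀
gcd[d,n/d]∣2*m₀ {n} {m₀} {m} m₀≤m n∣ = ∣m+n∣m⇒∣n (subst (h ∣_) m+m₀≡ h∣m+m₀) h∣m∸m₀
  where
  d = gcd n (m ∸ m₀)
  h = gcd d (n / d)
  h∣m∸m₀ : h ∣ m ∸ m₀
  h∣m∸m₀ = ∣-trans (gcd[m,n]∣m d (n / d)) (gcd[m,n]∣n n (m ∸ m₀))
  h∣m+m₀ : h ∣ m + m₀
  h∣m+m₀ = ∣-trans (gcd[m,n]∣n d (n / d)) (m∣n*o⇒m/gcd[m,n]∣o n (m ∸ m₀) (m + m₀) n∣)
  m+m₀≡ : m + m₀ ≡ (m ∸ m₀) + 2 * m₀
  m+m₀≡ = begin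
    m + m₀               ≡⟨ cong (_+ m₀) (sym (m∸n+n≡m m₀≤m)) ⟩
    (m ∸ m₀) + m₀ + m₀   ≡⟨ +-assoc (m ∸ m₀) m₀ m₀ ⟩
    (m ∸ m₀) + (m₀ + m₀) ≡⟨ cong (λ x → (m ∸ m₀) + (m₀ + x)) (sym (+-identityʳ m₀)) ⟩
    (m ∸ m₀) + 2 * m₀    ∎
    where open ≡-Reasoning

[L*N]²≤2nP⇒L²n≤8k²P : ∀ {L N n h k P} .{{_ : NonZero n}} → L * N * (L * N) ≤ n * (2 * P) →
                      h * N ≡ n → h ≤ 2 * k → L * L * n ≤ 8 * (k * k * P)
[L*N]²≤2nP⇒L²n≤8k²P {L} {N} {n} {h} {k} {P} [L*N]²≤ h*N≡n h≤2k = *-cancelʳ-≤ _ _ n (begin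
  L * L * n * n                   ≡⟨ cong (λ x → L * L * x * x) (sym h*N≡n) ⟩
  L * L * (h * N) * (h * N)       ≡⟨ regroup L h N ⟩
  L * N * (L * N) * (h * h)       ≤⟨ *-mono-≤ [L*N]²≤ (*-mono-≤ h≤2k h≤2k) ⟩
  n * (2 * P) * (2 * k * (2 * k)) ≡⟨ regroup′ n P k ⟩
  8 * (k * k * P) * n             ∎)
  where
  open ≤-Reasoning
  regroup : ∀ L h N → L * L * (h * N) * (h * N) ≡ L * N * (L * N) * (h * h)
  regroup = solve-∀
  regroup′ : ∀ n P k → n * (2 * P) * (2 * k * (2 * k)) ≡ 8 * (k * k * P) * n
  regroup′ = solve-∀

[1+L]²n≤32[n⊔X] : ∀ L n X → L * L * n ≤ 8 * X → suc L * suc L * n ≤ 32 * (n ⊔ X)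
[1+L]²n≤32[n⊔X] zero    n X _ =
  ≤-trans (≤-reflexive (+-identityʳ n)) (≤-trans (m≤m⊔n n X) (m≤n*m _ 32))
[1+L]²n≤32[n⊔X] (suc L) n X L²n≤8X = begin
  suc (suc L) * suc (suc L) * n ≤⟨ *-monoˡ-≤ n (*-mono-≤ 2+L≤2[1+L] 2+L≤2[1+L]) ⟩
  2 * suc L * (2 * suc L) * n   ≡⟨ regroup (suc L) n ⟩
  4 * (suc L * suc L * n)       ≤⟨ *-monoʳ-≤ 4 L²n≤8X ⟩
  4 * (8 * X)                   ≡⟨ sym (*-assoc 4 8 X) ⟩
  32 * X                        ≤⟨ *-monoʳ-≤ 32 (m≤n⊔m n X) ⟩
  32 * (n ⊔ X)                  ∎
  where
  open ≤-Reasoning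
  2+L≤2[1+L] : suc (suc L) ≤ 2 * suc L
  2+L≤2[1+L] = s≤s (subst (_≤ L + suc (L + 0)) (+-comm L 1) (+-monoʳ-≤ L (s≤s z≤n)))
  regroup : ∀ m n → 2 * m * (2 * m) * n ≡ 4 * (m * m * n)
  regroup = solve-∀

s*s*n≤L*L*M⇒ : ∀ q {s n L K M} → s * s * n ≤ L * L * M → L ^ q ≤ K * n →
               s ^ (2 * q) * n ^ q ≤ K * K * (n * n) * M ^ q
s*s*n≤L*L*M⇒ q {s} {n} {L} {K} {M} s²n≤L²M L^q≤Kn = begin
  s ^ (2 * q) * n ^ q     ≡⟨ cong (_* n ^ q) (x^[2*q]≡[x*x]^q s q) ⟩
  (s * s) ^ q * n ^ q     ≡⟨ sym (^-distribʳ-* (s * s) n q) ⟩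
  (s * s * n) ^ q         ≤⟨ ^-monoˡ-≤ q s²n≤L²M ⟩
  (L * L * M) ^ q         ≡⟨ trans (^-distribʳ-* (L * L) M q) (cong (_* M ^ q) (^-distribʳ-* L L q)) ⟩
  L ^ q * L ^ q * M ^ q   ≤⟨ *-monoˡ-≤ (M ^ q) (*-mono-≤ L^q≤Kn L^q≤Kn) ⟩
  K * n * (K * n) * M ^ q ≡⟨ cong (_* M ^ q) ([m*n]*[o*p]≡[m*o]*[n*p] K n K n) ⟩
  K * K * (n * n) * M ^ q ∎
  where open ≤-Reasoning

n*n≤n^[2*p] : ∀ n p .{{_ : NonZero n}} .{{_ : NonZero p}} → n * n ≤ n ^ (2 * p)
n*n≤n^[2*p] n p = subst (_≤ n ^ (2 * p)) (cong (n *_) (*-identityʳ n))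
                        (^-monoʳ-≤ n (*-monoʳ-≤ 2 (>-nonZero⁻¹ p)))

root : ℤ → ℕ
root z with isSquare? z
... | yes (m , _) = m
... | no _        = 0

IsSquare⇒≡root² : ∀ {z} → IsSquare z → z ≡ + (root z * root z)
IsSquare⇒≡root² {z} z-square with isSquare? z
... | yes (_ , z≡m²) = z≡m²
... | no ¬square     = contradiction z-square ¬square

module Squares (n : ℕ) .{{_ : NonZero n}} (b : ℤ) (P : ℕ) where

  value : ℕ → ℤ
  value i = + n ℤ.* (+ i ℤ.- + P) ℤ.+ b

  record Good (m : ℕ) : Set where
    constructor good
    field
      {index} : ℕ
      index≤  : index ≤ 2 * P
      square≡ : value index ≡ + (m * m)

  value-balance : ∀ {i j m m′} → value i ≡ + (m * m) → value j ≡ + (m′ * m′) →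
                  n * j + m * m ≡ n * i + m′ * m′
  value-balance {i} {j} {m} {m′} vᵢ≡ vⱼ≡ = ℤₚ.+-injective (begin
    + (n * j + m * m)         ≡⟨ ℤₚ.pos-+ (n * j) (m * m) ⟩
    + (n * j) ℤ.+ + (m * m)   ≡⟨ cong₂ ℤ._+_ (ℤₚ.pos-* n j) (sym vᵢ≡) ⟩
    + n ℤ.* + j ℤ.+ value i   ≡⟨ shift (+ n) (+ i) (+ j) (+ P) b ⟩
    + n ℤ.* + i ℤ.+ value j   ≡⟨ cong₂ ℤ._+_ (sym (ℤₚ.pos-* n i)) vⱼ≡ ⟩
    + (n * i) ℤ.+ + (m′ * m′) ≡⟨ sym (ℤₚ.pos-+ (n * i) (m′ * m′)) ⟩
    + (n * i + m′ * m′)       ∎)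
    where
    open ≡-Reasoning
    shift : ∀ N I J Q B → N ℤ.* J ℤ.+ (N ℤ.* (I ℤ.- Q) ℤ.+ B) ≡ N ℤ.* I ℤ.+ (N ℤ.* (J ℤ.- Q) ℤ.+ B)
    shift = ℤ-solve-∀

  root-mono : ∀ {i j m m′} → i < j → value i ≡ + (m * m) → value j ≡ + (m′ * m′) → m < m′
  root-mono {m = m} {m′} i<j vᵢ≡ vⱼ≡ = ≰⇒> λ m′≤m →
    <-irrefl (sym (value-balance {m = m} {m′} vᵢ≡ vⱼ≡))
             (+-mono-<-≤ (*-monoʳ-< n i<j) (*-mono-≤ m′≤m m′≤m))

  good-gap : ∀ {m m′} → Good m → Good m′ → m ≤ m′ → ∃[ t ] t ≤ 2 * P × m′ * m′ ≡ m * m + n * t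
  good-gap {m} {m′} (good {i} _ vᵢ≡) (good {j} j≤2P vⱼ≡) m≤m′ =
    j ∸ i , ≤-trans (m∸n≤m j i) j≤2P , +-cancelˡ-≡ (n * i) _ _ (begin
      n * i + m′ * m′               ≡⟨ sym (value-balance {m = m} {m′} vᵢ≡ vⱼ≡) ⟩
      n * j + m * m                 ≡⟨ cong (λ x → n * x + m * m) (sym (m+[n∸m]≡n i≤j)) ⟩
      n * (i + (j ∸ i)) + m * m     ≡⟨ cong (_+ m * m) (*-distribˡ-+ n i (j ∸ i)) ⟩
      n * i + n * (j ∸ i) + m * m   ≡⟨ +-assoc (n * i) _ _ ⟩
      n * i + (n * (j ∸ i) + m * m) ≡⟨ cong (λ x → n * i + x) (+-comm _ (m * m)) ⟩
      n * i + (m * m + n * (j ∸ i)) ∎)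
    where
    open ≡-Reasoning
    i≤j : i ≤ j
    i≤j = ≮⇒≥ λ j<i → <⇒≱ (root-mono {m = m′} {m} j<i vⱼ≡ vᵢ≡) m≤m′

  good⇒n∣[m∸m₀]*[m+m₀] : ∀ {m₀ m} → Good m₀ → Good m → m₀ ≤ m → n ∣ (m ∸ m₀) * (m + m₀)
  good⇒n∣[m∸m₀]*[m+m₀] {m₀} {m} good₀ good-m m₀≤m =
    let t , _ , m²≡ = good-gap good₀ good-m m₀≤m in divides t (begin
      (m ∸ m₀) * (m + m₀)       ≡⟨ [m∸n]*[m+n]≡m*m∸n*n m m₀ ⟩
      m * m ∸ m₀ * m₀           ≡⟨ cong (_∸ m₀ * m₀) m²≡ ⟩
      m₀ * m₀ + n * t ∸ m₀ * m₀ ≡⟨ m+n∸m≡n (m₀ * m₀) (n * t) ⟩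
      n * t                     ≡⟨ *-comm n t ⟩
      t * n                     ∎)
    where open ≡-Reasoning

  good⇒e²∣b : ∀ {m₀ e} → Good m₀ → e ∣ m₀ → e * e ∣ n → e * e ∣ ℤ.∣ b ∣
  good⇒e²∣b {m₀} {e} (good {i} _ vᵢ≡) e∣m₀ e²∣n = Signed.∣⇒∣ᵤ (subst (+ (e * e) Signed.∣_) m₀²-ny≡b
    (Signed.∣m∣n⇒∣m-n (Signed.∣ᵤ⇒∣ {+ (e * e)} {+ (m₀ * m₀)} (*-pres-∣ e∣m₀ e∣m₀))
                      (Signed.∣m⇒∣m*n y (Signed.∣ᵤ⇒∣ {+ (e * e)} {+ n} e²∣n))))
    where
    y = + i ℤ.- + P
    cancel : ∀ x y → x ℤ.+ y ℤ.- x ≡ y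
    cancel = ℤ-solve-∀
    m₀²-ny≡b : + (m₀ * m₀) ℤ.- + n ℤ.* y ≡ b
    m₀²-ny≡b = trans (cong (ℤ._- + n ℤ.* y) (sym vᵢ≡)) (cancel (+ n ℤ.* y) b)

  square? : Decidable (IsSquare ∘ value)
  square? i = isSquare? (value i)

  squareIndices : List ℕ
  squareIndices = filter square? (upTo (suc (2 * P)))

  roots : List ℕ
  roots = map (root ∘ value) squareIndices

  length-roots : length roots ≡ S P n b
  length-roots = begin
    length roots                     ≡⟨ length-map (root ∘ value) squareIndices ⟩
    length squareIndices             ≡⟨ sym (length-map point squareIndices) ⟩
    length (map point squareIndices) ≡⟨ cong length (sym (filter-map square?′ point (upTo (suc (2 * P))))) ⟩
    S P n b                          ∎
    where
    open ≡-Reasoning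
    point : ℕ → ℤ
    point i = + i ℤ.- + P
    square?′ : Decidable (λ y → IsSquare (+ n ℤ.* y ℤ.+ b))
    square?′ y = isSquare? (+ n ℤ.* y ℤ.+ b)

  roots-good : All Good roots
  roots-good = Allₚ.map⁺ (All.zipWith (λ (i≤2P , square) → good i≤2P (IsSquare⇒≡root² square))
    (Allₚ.filter⁺ square? (Allₚ.applyUpTo⁺₁ id (suc (2 * P)) ≤-pred) ,
     Allₚ.all-filter square? (upTo (suc (2 * P)))))

  roots-increasing : AllPairs _<_ roots
  roots-increasing = AllPairsₚ.map⁺ (AllPairs-mapWith
    (λ squareᵢ squareⱼ i<j → root-mono i<j (IsSquare⇒≡root² squareᵢ) (IsSquare⇒≡root² squareⱼ))
    (Allₚ.all-filter square? (upTo (suc (2 * P))))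
    (AllPairsₚ.filter⁺ square? (AllPairsₚ.applyUpTo⁺₁ id (suc (2 * P)) (λ i<j _ → i<j))))

  module _ {k} (largest : IsLargestSquareDivisor k (gcd n ℤ.∣ b ∣)) where

    good⇒e≤k : ∀ {m₀ e} → Good m₀ → e ∣ m₀ → e * e ∣ n → e ≤ k
    good⇒e≤k {e = e} good₀ e∣m₀ e²∣n =
      m*m≤n*n⇒m≤n (proj₂ largest e (gcd-greatest e²∣n (good⇒e²∣b good₀ e∣m₀ e²∣n)))

    module Classes (m₀ : ℕ) (good₀ : Good m₀) where

      class : ℕ → ℕ
      class m = gcd n (m ∸ m₀)

      Member : ℕ → Set
      Member m = Good m × m₀ ≤ m

      sameClass⇒spaced : ∀ {d y z} .{{_ : NonZero d}} → Member y → Member z →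
                         class y ≡ d → class z ≡ d → y < z → y + lcm d (n / d) ≤ z
      sameClass⇒spaced (good-y , m₀≤y) (good-z , m₀≤z) y∈d z∈d y<z = <∧∣∸⇒+≤ y<z
        (sameGcd⇒lcm∣∸ m₀≤y (<⇒≤ y<z) (good⇒n∣[m∸m₀]*[m+m₀] good₀ good-y m₀≤y)
                                      (good⇒n∣[m∸m₀]*[m+m₀] good₀ good-z m₀≤z) y∈d z∈d)

      gcd[class,n/class]≤2k : ∀ {m} → Member m → gcd (class m) (n / class m) ≤ 2 * k
      gcd[class,n/class]≤2k {m} (good-m , m₀≤m) =
        let h∣2m₀ = gcd[d,n/d]∣2*m₀ m₀≤m (good⇒n∣[m∸m₀]*[m+m₀] good₀ good-m m₀≤m)
            -- the instance is given explicitly: search cannot unify through the nested gcd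
            e , e∣m₀ , e∣h , h≤2e = ∣2*m⇒half∣m {{gcd≢0ˡ {class m} {n / class m}}} h∣2m₀
            e²∣n = ∣-trans (*-pres-∣ e∣h e∣h) (gcd[d,n/d]²∣n {n} {class m} (gcd[m,n]∣m n (m ∸ m₀)))
        in ≤-trans h≤2e (*-monoʳ-≤ 2 (good⇒e≤k good₀ e∣m₀ e²∣n))

      -- The class spans at most √(2nP), and its elements are spaced by lcm(d, n/d) = n/h ≥ n/(2k).
      classSpread : ∀ {x xs} → AllPairs _<_ (x ∷ xs) → All Member (x ∷ xs) →
                    All (λ y → class y ≡ class x) xs → length xs * length xs * n ≤ 8 * (k * k * P)
      classSpread {x} {xs} sorted members@(member-x ∷ _) same =
        let z , z∈ , x+LN≤z = separated-spread separated
            t , t≤2P , z²≡ = good-gap (proj₁ member-x) (proj₁ (All.lookup members z∈))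
                                      (m+n≤o⇒m≤o x x+LN≤z)
            [LN]²≤2nP = ≤-trans (square-gap {x = x} x+LN≤z z²≡) (*-monoʳ-≤ n t≤2P)
        in [L*N]²≤2nP⇒L²n≤8k²P {L = length xs} {k = k} {P = P} [LN]²≤2nP
             (gcd[d,n/d]*lcm[d,n/d]≡n (gcd[m,n]∣m n (x ∸ m₀))) (gcd[class,n/class]≤2k member-x)
        where
        d = class x
        separated : AllPairs (λ y z → y + lcm d (n / d) ≤ z) (x ∷ xs)
        separated = AllPairs-mapWith (λ (member-y , y∈d) (member-z , z∈d) →
                                        sameClass⇒spaced member-y member-z y∈d z∈d)
                                     (All.zip (members , refl ∷ same)) sorted

      classSize : ∀ {d} cs → AllPairs _<_ cs → All Member cs → All (λ y → class y ≡ d) cs →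
                  length cs * length cs * n ≤ 32 * (n ⊔ k * k * P)
      classSize []       _      _       _            = z≤n
      classSize (x ∷ xs) sorted members (x∈d ∷ xs∈d) = [1+L]²n≤32[n⊔X] (length xs) n _
        (classSpread sorted members (All.map (λ y∈d → trans y∈d (sym x∈d)) xs∈d))

    S²n≤ : ∀ D → DivisorCover n D →
           S P n b * S P n b * n ≤ length D * length D * (32 * (n ⊔ k * k * P))
    S²n≤ D cover = subst (λ s → s * s * n ≤ length D * length D * (32 * (n ⊔ k * k * P)))
                         length-roots (bound roots roots-increasing roots-good)
      where
      bound : ∀ ms → AllPairs _<_ ms → All Good ms →
              length ms * length ms * n ≤ length D * length D * (32 * (n ⊔ k * k * P))
      bound []             _                    _                 = z≤n
      bound ms@(m₀ ∷ rest) sorted@(m₀<rest ∷ _) goods@(good₀ ∷ _) =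
        let d , |ms|≤|D|*c = pigeonhole class D ms (All.tabulate λ {m} _ → cover (gcd[m,n]∣m n (m ∸ m₀)))
        in viaClass d |ms|≤|D|*c
        where
        open Classes m₀ good₀
        members : All Member ms
        members = All.zip (goods , ≤-refl ∷ All.map <⇒≤ m₀<rest)
        viaClass : ∀ d → length ms ≤ length D * length (fibre class d ms) →
                   length ms * length ms * n ≤ length D * length D * (32 * (n ⊔ k * k * P))
        viaClass d |ms|≤|D|*c = begin
          length ms * length ms * n         ≤⟨ *-monoˡ-≤ n (*-mono-≤ |ms|≤|D|*c |ms|≤|D|*c) ⟩
          length D * c * (length D * c) * n ≡⟨ regroup (length D) c n ⟩
          length D * length D * (c * c * n) ≤⟨ *-monoʳ-≤ (length D * length D) c²n≤ ⟩
          length D * length D * (32 * (n ⊔ k * k * P)) ∎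
          where
          open ≤-Reasoning
          in-d? = λ m → class m ≟ d
          c = length (fibre class d ms)
          c²n≤ : c * c * n ≤ 32 * (n ⊔ k * k * P)
          c²n≤ = classSize (fibre class d ms) (AllPairsₚ.filter⁺ in-d? sorted)
                           (Allₚ.filter⁺ in-d? members) (Allₚ.all-filter in-d? ms)
          regroup : ∀ L c n → L * c * (L * c) * n ≡ L * L * (c * c * n)
          regroup = solve-∀

lemma2p3 : (p q : ℕ) → .{{_ : NonZero p}} → .{{_ : NonZero q}} →
    ∃[ C ] ((n : ℕ) → .{{_ : NonZero n}} → (b : ℤ) → (P : ℕ) → (k : ℕ) →
      IsLargestSquareDivisor k (gcd n ℤ.∣ b ∣) →
      S P n b ^ (2 * q) * n ^ q ≤ C * n ^ (2 * p) * (n ^ q ⊔ k ^ (2 * q) * P ^ q))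
lemma2p3 p q = K * K * 32 ^ q , λ n b P k largest →
  let D , cover , |D|^q≤Kn = divisorCover n
      M = n ⊔ k * k * P
      S²n≤|D|²32M = Squares.S²n≤ n b P {k} largest D cover
  in begin
    S P n b ^ (2 * q) * n ^ q          ≤⟨ s*s*n≤L*L*M⇒ q {K = K} S²n≤|D|²32M |D|^q≤Kn ⟩
    K * K * (n * n) * (32 * M) ^ q     ≡⟨ cong (K * K * (n * n) *_) (^-distribʳ-* 32 M q) ⟩
    K * K * (n * n) * (32 ^ q * M ^ q) ≡⟨ regroup (K * K) (n * n) (32 ^ q) (M ^ q) ⟩
    K * K * 32 ^ q * (n * n) * M ^ q   ≤⟨ *-mono-≤ (*-monoʳ-≤ (K * K * 32 ^ q) (n*n≤n^[2*p] n p))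
                                                   (≤-reflexive (M^q≡ n k P)) ⟩
    K * K * 32 ^ q * n ^ (2 * p) * (n ^ q ⊔ k ^ (2 * q) * P ^ q) ∎
  where
  open ≤-Reasoning
  open DivisorBound q
  K = Q ^ R
  regroup : ∀ a b c d → a * b * (c * d) ≡ a * c * b * d
  regroup = solve-∀
  M^q≡ : ∀ n k P → (n ⊔ k * k * P) ^ q ≡ n ^ q ⊔ k ^ (2 * q) * P ^ q
  M^q≡ n k P = trans (mono-≤-distrib-⊔ (^-monoˡ-≤ q) n (k * k * P))
    (cong (n ^ q ⊔_) (trans (^-distribʳ-* (k * k) P q) (cong (_* P ^ q) (sym (x^[2*q]≡[x*x]^q k q)))))
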